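{- For all integers $n,k$ with $n \ge 4$ and $n > k \ge 1$, the Johnson graph $J(n,k)$ is paired 2-coverable.
   Context: Let $[n]=\{1,2,\dots,n\}$. The Johnson graph $J(n,k)$ has as vertices the $k$-element subsets of $[n]$, two vertices being adjacent if the corresponding $k$-subsets have exactly $k-1$ elements in common. A graph $G$ is called paired 2-coverable if for any four distinct vertices $u,v,x,y$ of $G$ (i.e. any two disjoint vertex sets $S=\{u,x\}$ and $T=\{v,y\}$) there exist two vertex-disjoint paths in $G$, one with endpoints $u$ and $v$ and the other with endpoints $x$ and $y$, which together cover every vertex of $G$. -}

module Defs where

open import Data.Nat using (ℕ; _∸_)
open import Data.Fin.Subset using (Subset; ∣_∣; _∩_)
open import Data.Product using (Σ; ∃; ∃-syntax; _×_; _,_)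
open import Data.Sum using (_⊎_)
open import Data.List using (List; _∷_; _∷ʳ_)
open import Data.List.Relation.Unary.Linked using (Linked)
open import Data.List.Relation.Unary.Unique.Propositional using (Unique)
open import Data.List.Relation.Binary.Disjoint.Propositional using (Disjoint)
open import Data.List.Membership.Propositional using (_∈_)
open import Relation.Binary.PropositionalEquality using (_≡_; _≢_)

IsPath : {V : Set} → (V → V → Set) → List V → Set
IsPath Adj xs = Linked Adj xs × Unique xs

PathBetween : {V : Set} → (V → V → Set) → V → V → List V → Set
PathBetween Adj a b xs = ∃[ mid ] (xs ≡ (a ∷ mid) ∷ʳ b) × IsPath Adj xs

PairedTwoCoverable : (V : Set) → (V → V → Set) → Set
PairedTwoCoverable V Adj =
  (u v x y : V) →
  u ≢ v → u ≢ x → u ≢ y → v ≢ x → v ≢ y → x ≢ y →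
  ∃[ P ] ∃[ Q ]
    PathBetween Adj u v P × PathBetween Adj x y Q × Disjoint P Q ×
    ((w : V) → w ∈ P ⊎ w ∈ Q)

JVertex : ℕ → ℕ → Set
JVertex n k = Σ (Subset n) (λ s → ∣ s ∣ ≡ k)

JAdj : (n k : ℕ) → JVertex n k → JVertex n k → Set
JAdj n k (s , _) (t , _) = ∣ s ∩ t ∣ ≡ k ∸ 1

-- Induction on n, proving together with paired 2-coverability that J(n,k) is Hamiltonian-connected; the
-- graphs J(4,k) are settled by exhaustive search. For k = 1 and k = n-1, J(n,k) is J(n-1,k′) plus a vertex
-- adjacent to all others, which is inserted into the paths given by induction. Otherwise the sets containing
-- an element e and those avoiding it split J(n,k) into copies of J(n-1,k-1) and J(n-1,k), and every vertex
-- has two neighbours in the other part; paths in the parts are joined along cross edges. Choose e so that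
-- u and v (or x and y) lie in the same part. If there is no such e, then v and y are the complements of
-- u and x, so n = 2k, and for e = 0 there are two disjoint cross edges avoiding the terminals, along which
-- both paths cross.

module Submission where

open import Defs
open import Data.Unit using (tt)
import Data.Unit as Unit
open import Data.Empty using (⊥-elim)
import Data.Empty as Empty
open import Data.Nat using (ℕ; zero; suc; _+_; _∸_; _≤_; _<_; z≤n; s≤s)
import Data.Nat.Properties as ℕ
open import Data.Bool using (true; false; _∧_; not)
import Data.Bool.Properties as Bool
open import Data.Fin using (Fin; zero; suc)
import Data.Fin.Properties as Fin
open import Data.Vec using ([]; _∷_; lookup; insertAt; removeAt; _[_]≔_; tail)
import Data.Vec.Properties as Vec
open import Data.Fin.Subset using (Subset; ∣_∣; _∩_; ∁; ⊥; ⊤)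
import Data.Fin.Subset.Properties as Subset
open import Data.Product using (∃-syntax; _×_; _,_; proj₁; proj₂)
import Data.Product as Product
open import Data.Sum using (_⊎_; inj₁; inj₂; [_,_]′)
import Data.Sum as Sum
open import Data.List using (List; []; _∷_; _∷ʳ_; _++_; map; reverse; [_]; length; concatMap; filter; zip; inits; tails)
open import Data.List.Properties using (unfold-reverse; ++-identityʳ; length-++; length-map)
open import Data.List.Relation.Unary.All using (All; []; _∷_)
import Data.List.Relation.Unary.All as All
open import Data.List.Relation.Unary.Any using (Any; here; there)
import Data.List.Relation.Unary.Any as Any
import Data.List.Relation.Unary.Any.Properties as Anyₚ
open import Data.List.Relation.Unary.AllPairs using ([]; _∷_)
import Data.List.Relation.Unary.AllPairs as AllPairs
open import Data.List.Relation.Unary.Linked using (Linked; [-]; _∷_)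
import Data.List.Relation.Unary.Linked as Linked
import Data.List.Relation.Unary.Linked.Properties as Linked
open import Data.List.Relation.Unary.Unique.Propositional using (Unique)
import Data.List.Relation.Unary.Unique.Propositional.Properties as Unique
open import Data.List.Relation.Binary.Disjoint.Propositional using (Disjoint)
open import Data.List.Membership.Propositional using (_∈_; _∉_)
open import Data.List.Membership.Propositional.Properties using (∈-++⁺ˡ; ∈-++⁺ʳ; ∈-++⁻; ∈-map⁺; ∈-map⁻)
open import Relation.Binary.Definitions using (DecidableEquality; Decidable)
open import Relation.Binary.PropositionalEquality
  using (_≡_; _≢_; refl; sym; trans; cong; cong₂; subst; ≢-sym; module ≡-Reasoning)
open import Relation.Nullary using (yes; no; Dec)
open import Relation.Nullary.Decidable using (_×-dec_; _⊎-dec_; _→-dec_; ¬?; True; toWitness)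
open import Relation.Nullary.Negation using (contraposition)
open import Function using (_∘_; case_of_)

data Ends {V : Set} : V → V → List V → Set where
  single : ∀ {a} → Ends a a [ a ]
  cons   : ∀ {a b c xs} → Ends b c xs → Ends a c (a ∷ xs)

Path : {V : Set} → (V → V → Set) → V → V → List V → Set
Path Adj a b xs = Ends a b xs × IsPath Adj xs

module _ {V : Set} where

  Ends-head : ∀ {a b : V} {xs} → Ends a b xs → ∃[ ys ] xs ≡ a ∷ ys
  Ends-head single   = _ , refl
  Ends-head (cons _) = _ , refl

  Ends-++ : ∀ {a b c d : V} {xs ys} → Ends a b xs → Ends c d ys → Ends a d (xs ++ ys)
  Ends-++ single   e = cons e
  Ends-++ (cons e) f = cons (Ends-++ e f)

  Ends-reverse : ∀ {a b : V} {xs} → Ends a b xs → Ends b a (reverse xs)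
  Ends-reverse single = single
  Ends-reverse {a} (cons {xs = xs} e) rewrite unfold-reverse a xs = Ends-++ (Ends-reverse e) single

  Ends-∷ʳ : ∀ {a b : V} mid → Ends a b ((a ∷ mid) ∷ʳ b)
  Ends-∷ʳ []        = cons single
  Ends-∷ʳ (_ ∷ mid) = cons (Ends-∷ʳ mid)

  Ends-last : ∀ {a b : V} {xs} → Ends a b xs → ∃[ ys ] xs ≡ ys ∷ʳ b
  Ends-last single = [] , refl
  Ends-last {a} (cons e) with ys , refl ← Ends-last e = a ∷ ys , refl

  Ends⇒∷ʳ : ∀ {a b : V} {xs} → Ends a b xs → a ≢ b → ∃[ mid ] xs ≡ (a ∷ mid) ∷ʳ b
  Ends⇒∷ʳ single   a≢b = ⊥-elim (a≢b refl)
  Ends⇒∷ʳ (cons e) _   with mid , refl ← Ends-last e = mid , refl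

  Unique-reverse : ∀ {xs : List V} → Unique xs → Unique (reverse xs)
  Unique-reverse {[]}     u = u
  Unique-reverse {x ∷ xs} (x∉xs ∷ u) rewrite unfold-reverse x xs =
    Unique.++⁺ (Unique-reverse u) ([] ∷ [])
      λ { (x∈rev , here refl) → All.lookup x∉xs (Anyₚ.reverse⁻ x∈rev) refl }

Ends-map : ∀ {V W : Set} (f : V → W) {a b xs} → Ends a b xs → Ends (f a) (f b) (map f xs)
Ends-map f single   = single
Ends-map f (cons e) = cons (Ends-map f e)

module _ {V : Set} {Adj : V → V → Set} where

  Linked-++ : ∀ {a b c d : V} {xs ys} → Ends a b xs → Ends c d ys →
              Linked Adj xs → Adj b c → Linked Adj ys → Linked Adj (xs ++ ys)
  Linked-++ single f _ r l with _ , refl ← Ends-head f = r ∷ l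
  Linked-++ (cons e) f l r l′ with _ , refl ← Ends-head e with s ∷ l ← l = s ∷ Linked-++ e f l r l′

  Path-[_] : ∀ a → Path Adj a a [ a ]
  Path-[ a ] = single , [-] , [] ∷ []

  Path-++ : ∀ {a b c d : V} {xs ys} → Path Adj a b xs → Path Adj c d ys → Adj b c → Disjoint xs ys →
            Path Adj a d (xs ++ ys)
  Path-++ (e , l , u) (f , l′ , u′) r dj = Ends-++ e f , Linked-++ e f l r l′ , Unique.++⁺ u u′ dj

  Path-uncons : ∀ {a b : V} {xs} → Path Adj a b xs → a ≢ b →
                ∃[ r ] ∃[ ys ] xs ≡ a ∷ r ∷ ys × a ∉ r ∷ ys × Path Adj r b (r ∷ ys)
  Path-uncons (single , _ , _) a≢b = ⊥-elim (a≢b refl)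
  Path-uncons (cons e , l , u) _ with _ , refl ← Ends-head e with _ ∷ l ← l with a∉ ∷ u ← u =
    _ , _ , refl , (λ m → All.lookup a∉ m refl) , e , l , u

  Path⇒PathBetween : ∀ {a b : V} {xs} → Path Adj a b xs → a ≢ b → PathBetween Adj a b xs
  Path⇒PathBetween (e , l , u) a≢b with mid , eq ← Ends⇒∷ʳ e a≢b = mid , eq , l , u

  module _ (Adj-sym : ∀ {a b} → Adj a b → Adj b a) where

    Linked-reverse : ∀ {a b : V} {xs} → Ends a b xs → Linked Adj xs → Linked Adj (reverse xs)
    Linked-reverse single l = l
    Linked-reverse {a} (cons {xs = xs} e) l with _ , refl ← Ends-head e with s ∷ l ← l
      rewrite unfold-reverse a xs = Linked-++ (Ends-reverse e) single (Linked-reverse e l) (Adj-sym s) [-]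

    Path-reverse : ∀ {a b : V} {xs} → Path Adj a b xs → Path Adj b a (reverse xs)
    Path-reverse (e , l , u) = Ends-reverse e , Linked-reverse e l , Unique-reverse u

module _ {V : Set} (_≟_ : DecidableEquality V) where
  open import Data.List.Membership.DecPropositional _≟_ using (_∈?_)

  private
    remove : ∀ {d : V} {F} → d ∈ F →
             ∃[ F′ ] suc (length F′) ≡ length F × (∀ {z} → z ∈ F → z ≡ d ⊎ z ∈ F′)
    remove (here refl) = _ , refl , λ { (here eq) → inj₁ eq ; (there m) → inj₂ m }
    remove {F = x ∷ _} (there m) with F′ , eq , split ← remove m =
      x ∷ F′ , cong suc eq , λ { (here eq) → inj₂ (here eq) ; (there n) → Sum.map₂ there (split n) }

  ∃-∉-longer : ∀ {L F : List V} → Unique L → length F < length L → ∃[ d ] d ∈ L × d ∉ F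
  ∃-∉-longer {x ∷ L} {F} (x∉L ∷ u) F<L with x ∈? F
  ... | no x∉F = x , here refl , x∉F
  ... | yes x∈F with F′ , eq , split ← remove x∈F
    with d , d∈L , d∉F′ ← ∃-∉-longer u (ℕ.≤-pred (subst (_< suc (length L)) (sym eq) F<L)) =
    d , there d∈L , [ (λ d≡x → All.lookup x∉L d∈L (sym d≡x)) , d∉F′ ]′ ∘ split

  ∃₂-∉-longer : ∀ {L F : List V} → Unique L → 2 + length F ≤ length L →
                ∃[ r ] ∃[ r′ ] r ∈ L × r′ ∈ L × r ∉ F × r′ ∉ r ∷ F
  ∃₂-∉-longer u F<L
    with r , r∈ , r∉ ← ∃-∉-longer u (ℕ.≤-trans (ℕ.n≤1+n _) F<L)
    with r′ , r′∈ , r′∉ ← ∃-∉-longer u F<L = r , r′ , r∈ , r′∈ , r∉ , r′∉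

-- Graphs, linkages and Hamiltonian connectivity

record Graph : Set₁ where
  field
    V       : Set
    Adj     : V → V → Set
    Adj-sym : ∀ {a b} → Adj a b → Adj b a
    _≟_     : DecidableEquality V

record Distinct {V : Set} (u v x y : V) : Set where
  field
    u≢v : u ≢ v
    u≢x : u ≢ x
    u≢y : u ≢ y
    v≢x : v ≢ x
    v≢y : v ≢ y
    x≢y : x ≢ y

module _ {V : Set} where

  Distinct-swap : ∀ {u v x y : V} → Distinct u v x y → Distinct x y u v
  Distinct-swap d = record
    { u≢v = x≢y ; u≢x = ≢-sym u≢x ; u≢y = ≢-sym v≢x
    ; v≢x = ≢-sym u≢y ; v≢y = ≢-sym v≢y ; x≢y = u≢v }
    where open Distinct d

  Distinct-reverseˡ : ∀ {u v x y : V} → Distinct u v x y → Distinct v u x y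
  Distinct-reverseˡ d = record
    { u≢v = ≢-sym u≢v ; u≢x = v≢x ; u≢y = v≢y ; v≢x = u≢x ; v≢y = u≢y ; x≢y = x≢y }
    where open Distinct d

  Distinct-reverseʳ : ∀ {u v x y : V} → Distinct u v x y → Distinct u v y x
  Distinct-reverseʳ = Distinct-swap ∘ Distinct-reverseˡ ∘ Distinct-swap

Distinct-unmap : ∀ {V W : Set} (f : W → V) {u v x y} → Distinct (f u) (f v) (f x) (f y) → Distinct u v x y
Distinct-unmap f d = record
  { u≢v = unmap u≢v ; u≢x = unmap u≢x ; u≢y = unmap u≢y
  ; v≢x = unmap v≢x ; v≢y = unmap v≢y ; x≢y = unmap x≢y }
  where open Distinct d ; unmap = λ {p} {q} → contraposition (cong f {p} {q})

module _ (G : Graph) where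
  open Graph G

  HamiltonianConnected : Set
  HamiltonianConnected = ∀ {a b} → a ≢ b → ∃[ P ] Path Adj a b P × (∀ w → w ∈ P)

  Linkage : V → V → V → V → Set
  Linkage u v x y = ∃[ P ] ∃[ Q ] Path Adj u v P × Path Adj x y Q × Disjoint P Q × (∀ w → w ∈ P ⊎ w ∈ Q)

  Linkable : Set
  Linkable = ∀ {u v x y} → Distinct u v x y → Linkage u v x y

  AtLeastFour : Set
  AtLeastFour = ∀ (a b c : V) → ∃[ d ] d ≢ a × d ≢ b × d ≢ c

  record Spanning : Set where
    field
      hamiltonian : HamiltonianConnected
      linkable    : Linkable

  Linkage-swap : ∀ {u v x y} → Linkage u v x y → Linkage x y u v
  Linkage-swap (P , Q , p , q , dj , cv) = Q , P , q , p , dj ∘ Product.swap , Sum.swap ∘ cv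

  Linkage-reverseˡ : ∀ {u v x y} → Linkage u v x y → Linkage v u x y
  Linkage-reverseˡ (P , Q , p , q , dj , cv) =
    reverse P , Q , Path-reverse Adj-sym p , q ,
    (λ (m , n) → dj (Anyₚ.reverse⁻ m , n)) , [ inj₁ ∘ Anyₚ.reverse⁺ , inj₂ ]′ ∘ cv

  Linkage-reverseʳ : ∀ {u v x y} → Linkage u v x y → Linkage u v y x
  Linkage-reverseʳ = Linkage-swap ∘ Linkage-reverseˡ ∘ Linkage-swap

  Linkable⇒PairedTwoCoverable : Linkable → PairedTwoCoverable V Adj
  Linkable⇒PairedTwoCoverable link u v x y u≢v u≢x u≢y v≢x v≢y x≢y
    with P , Q , p , q , dj , cv ← link (record
           { u≢v = u≢v ; u≢x = u≢x ; u≢y = u≢y ; v≢x = v≢x ; v≢y = v≢y ; x≢y = x≢y }) =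
    P , Q , Path⇒PathBetween p u≢v , Path⇒PathBetween q x≢y , dj , cv

-- Partitions into two (not necessarily induced) subgraphs

record Partition (G A B : Graph) : Set where
  module G = Graph G
  module A = Graph A
  module B = Graph B
  field
    inA           : A.V → G.V
    inB           : B.V → G.V
    inA-injective : ∀ {a a′} → inA a ≡ inA a′ → a ≡ a′
    inB-injective : ∀ {b b′} → inB b ≡ inB b′ → b ≡ b′
    inA-Adj       : ∀ {a a′} → A.Adj a a′ → G.Adj (inA a) (inA a′)
    inB-Adj       : ∀ {b b′} → B.Adj b b′ → G.Adj (inB b) (inB b′)
    inA≢inB       : ∀ a b → inA a ≢ inB b
    cover         : ∀ w → (∃[ a ] inA a ≡ w) ⊎ (∃[ b ] inB b ≡ w)

Partition-flip : ∀ {G A B} → Partition G A B → Partition G B A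
Partition-flip P = record
  { inA = inB ; inB = inA ; inA-injective = inB-injective ; inB-injective = inA-injective
  ; inA-Adj = inB-Adj ; inB-Adj = inA-Adj
  ; inA≢inB = λ b a → ≢-sym (inA≢inB a b)
  ; cover = Sum.swap ∘ cover }
  where open Partition P

module PartitionPaths {G A B : Graph} (P : Partition G A B) where
  open Partition P

  liftA : ∀ {a a′ X} → Path A.Adj a a′ X → Path G.Adj (inA a) (inA a′) (map inA X)
  liftA (e , l , u) = Ends-map inA e , Linked.map⁺ (Linked.map inA-Adj l) , Unique.map⁺ inA-injective u

  liftB : ∀ {b b′ Y} → Path B.Adj b b′ Y → Path G.Adj (inB b) (inB b′) (map inB Y)
  liftB (e , l , u) = Ends-map inB e , Linked.map⁺ (Linked.map inB-Adj l) , Unique.map⁺ inB-injective u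

  inA-inB-disjoint : ∀ X Y → Disjoint (map inA X) (map inB Y)
  inA-inB-disjoint X Y (m , n) with a , _ , refl ← ∈-map⁻ inA m with b , _ , eq ← ∈-map⁻ inB n =
    inA≢inB a b eq

  record Image (L : List G.V) (X : List A.V) (Y : List B.V) : Set where
    field
      ⊆-images : ∀ {w} → w ∈ L → (∃[ a ] a ∈ X × w ≡ inA a) ⊎ (∃[ b ] b ∈ Y × w ≡ inB b)
      inA-⊆    : ∀ {a} → a ∈ X → inA a ∈ L
      inB-⊆    : ∀ {b} → b ∈ Y → inB b ∈ L
  open Image

  Image-inA : ∀ X → Image (map inA X) X []
  Image-inA X = record { ⊆-images = inj₁ ∘ ∈-map⁻ inA ; inA-⊆ = ∈-map⁺ inA ; inB-⊆ = λ () }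

  Image-inB : ∀ Y → Image (map inB Y) [] Y
  Image-inB Y = record { ⊆-images = inj₂ ∘ ∈-map⁻ inB ; inA-⊆ = λ () ; inB-⊆ = ∈-map⁺ inB }

  Image-++ : ∀ {L X Y L′ X′ Y′} → Image L X Y → Image L′ X′ Y′ → Image (L ++ L′) (X ++ X′) (Y ++ Y′)
  Image-++ {L} {X} {Y} i i′ = record
    { ⊆-images = λ m → [ Sum.map (inj-∈ (∈-++⁺ˡ)) (inj-∈ ∈-++⁺ˡ) ∘ ⊆-images i
                       , Sum.map (inj-∈ (∈-++⁺ʳ X)) (inj-∈ (∈-++⁺ʳ Y)) ∘ ⊆-images i′ ]′ (∈-++⁻ L m)
    ; inA-⊆ = [ ∈-++⁺ˡ ∘ inA-⊆ i , ∈-++⁺ʳ L ∘ inA-⊆ i′ ]′ ∘ ∈-++⁻ X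
    ; inB-⊆ = [ ∈-++⁺ˡ ∘ inB-⊆ i , ∈-++⁺ʳ L ∘ inB-⊆ i′ ]′ ∘ ∈-++⁻ Y }
    where
    inj-∈ : ∀ {S : Set} {w} {f : S → G.V} {Z Z′ : List S} →
            (∀ {s} → s ∈ Z → s ∈ Z′) → ∃[ s ] s ∈ Z × w ≡ f s → ∃[ s ] s ∈ Z′ × w ≡ f s
    inj-∈ ⊆ (s , m , eq) = s , ⊆ m , eq

  Image-inA-++-inB : ∀ X Y → Image (map inA X ++ map inB Y) X Y
  Image-inA-++-inB X Y =
    subst (λ X′ → Image (map inA X ++ map inB Y) X′ Y) (++-identityʳ X) (Image-++ (Image-inA X) (Image-inB Y))

  Image-inB-++-inA : ∀ Y X → Image (map inB Y ++ map inA X) X Y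
  Image-inB-++-inA Y X =
    subst (Image (map inB Y ++ map inA X) X) (++-identityʳ Y) (Image-++ (Image-inB Y) (Image-inA X))

  Image-disjoint : ∀ {L X Y L′ X′ Y′} → Image L X Y → Image L′ X′ Y′ → Disjoint X X′ → Disjoint Y Y′ →
                   Disjoint L L′
  Image-disjoint i i′ dx dy {w} (m , m′) with ⊆-images i m | ⊆-images i′ m′
  ... | inj₁ (a , n , refl) | inj₁ (_ , n′ , eq) = dx (n , subst (_∈ _) (sym (inA-injective eq)) n′)
  ... | inj₁ (a , _ , refl) | inj₂ (b , _ , eq) = inA≢inB a b eq
  ... | inj₂ (b , _ , refl) | inj₁ (a , _ , eq) = inA≢inB a b (sym eq)
  ... | inj₂ (b , n , refl) | inj₂ (_ , n′ , eq) = dy (n , subst (_∈ _) (sym (inB-injective eq)) n′)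

  Image-covers : ∀ {L X Y} → Image L X Y → (∀ a → a ∈ X) → (∀ b → b ∈ Y) → ∀ w → w ∈ L
  Image-covers i allX allY w with cover w
  ... | inj₁ (a , refl) = inA-⊆ i (allX a)
  ... | inj₂ (b , refl) = inB-⊆ i (allY b)

  linkage-of-images : ∀ {u v x y L X Y L′ X′ Y′} → Path G.Adj u v L → Path G.Adj x y L′ →
                      Image L X Y → Image L′ X′ Y′ → Disjoint X X′ → Disjoint Y Y′ →
                      (∀ a → a ∈ X ⊎ a ∈ X′) → (∀ b → b ∈ Y ⊎ b ∈ Y′) → Linkage G u v x y
  linkage-of-images {L = L} {L′ = L′} p q i i′ dx dy cx cy = L , L′ , p , q , Image-disjoint i i′ dx dy , covers
    where
    covers : ∀ w → w ∈ L ⊎ w ∈ L′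
    covers w with cover w
    ... | inj₁ (a , refl) = Sum.map (inA-⊆ i) (inA-⊆ i′) (cx a)
    ... | inj₂ (b , refl) = Sum.map (inB-⊆ i) (inB-⊆ i′) (cy b)

  Path-inA-++-inB : ∀ {a a′ b b′ X Y} → Path A.Adj a a′ X → Path B.Adj b b′ Y → G.Adj (inA a′) (inB b) →
                    Path G.Adj (inA a) (inB b′) (map inA X ++ map inB Y)
  Path-inA-++-inB {X = X} {Y} p q r = Path-++ (liftA p) (liftB q) r (inA-inB-disjoint X Y)

  splice : ∀ {a b b′ r c Y R} → G.Adj (inA a) (inB b) → Path B.Adj b b′ Y → G.Adj (inB b′) (inA r) →
           Path A.Adj r c (r ∷ R) → a ∉ r ∷ R →
           Path G.Adj (inA a) (inA c) (inA a ∷ map inB Y ++ map inA (r ∷ R)) ×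
           Image (inA a ∷ map inB Y ++ map inA (r ∷ R)) (a ∷ r ∷ R) Y
  splice {a} {r = r} {Y = Y} {R = R} ab q b′r p a∉rR =
    Path-++ (liftA Path-[ a ]) rest ab a-fresh ,
    Image-++ (Image-inA [ a ]) (Image-inB-++-inA Y (r ∷ R))
    where
    rest = Path-++ (liftB q) (liftA p) b′r (inA-inB-disjoint (r ∷ R) Y ∘ Product.swap)
    a-fresh : Disjoint [ inA a ] (map inB Y ++ map inA (r ∷ R))
    a-fresh (here refl , m) with ∈-++⁻ (map inB Y) m
    ... | inj₁ n = inA-inB-disjoint [ a ] Y (here refl , n)
    ... | inj₂ n with a′ , n′ , eq ← ∈-map⁻ inA n = a∉rR (subst (_∈ r ∷ R) (sym (inA-injective eq)) n′)

  inA-≢ : ∀ {a a′} → inA a ≢ inA a′ → a ≢ a′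
  inA-≢ = contraposition (cong inA)

  inB-≢ : ∀ {b b′} → inB b ≢ inB b′ → b ≢ b′
  inB-≢ = contraposition (cong inB)

  SameSide : G.V → G.V → Set
  SameSide u v = (∃[ a ] ∃[ a′ ] inA a ≡ u × inA a′ ≡ v) ⊎ (∃[ b ] ∃[ b′ ] inB b ≡ u × inB b′ ≡ v)

module _ {G A B : Graph} (P : Partition G A B) where
  open Partition P

  record TwoCrossNeighbours : Set where
    field
      neighboursᴮ : ∀ a → ∃[ b ] ∃[ b′ ] b ≢ b′ × G.Adj (inA a) (inB b) × G.Adj (inA a) (inB b′)
      neighboursᴬ : ∀ b → ∃[ a ] ∃[ a′ ] a ≢ a′ × G.Adj (inB b) (inA a) × G.Adj (inB b) (inA a′)

  CrossMatching : Set
  CrossMatching = ∀ {a₁ a₂ b₁ b₂} → a₁ ≢ a₂ → b₁ ≢ b₂ →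
    ∃[ a ] ∃[ a′ ] ∃[ b ] ∃[ b′ ] Distinct a₁ a a₂ a′ × Distinct b b₁ b′ b₂ ×
    G.Adj (inA a) (inB b) × G.Adj (inA a′) (inB b′)

TwoCrossNeighbours-flip : ∀ {G A B} {P : Partition G A B} → TwoCrossNeighbours P →
                          TwoCrossNeighbours (Partition-flip P)
TwoCrossNeighbours-flip T = record { neighboursᴮ = neighboursᴬ ; neighboursᴬ = neighboursᴮ }
  where open TwoCrossNeighbours T

module CrossLinking {G A B : Graph} (P : Partition G A B) (T : TwoCrossNeighbours P)
  (SA : Spanning A) (SB : Spanning B) (fourA : AtLeastFour A) where
  open Partition P
  open PartitionPaths P
  open TwoCrossNeighbours T
  open Spanning SA renaming (hamiltonian to hamiltonianᴬ; linkable to linkableᴬ)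
  open Spanning SB renaming (hamiltonian to hamiltonianᴮ; linkable to linkableᴮ)

  cross-neighbour : ∀ a b → ∃[ b′ ] b′ ≢ b × G.Adj (inA a) (inB b′)
  cross-neighbour a b with b₁ , b₂ , b₁≢b₂ , ab₁ , ab₂ ← neighboursᴮ a with b₁ B.≟ b
  ... | yes refl = b₂ , ≢-sym b₁≢b₂ , ab₂
  ... | no b₁≢b  = b₁ , b₁≢b , ab₁

  -- Since a is adjacent to b and its successor r to some b′ ≠ b, a Hamiltonian path of B fits between them.
  absorbB : ∀ {a c X} → Path A.Adj a c X → a ≢ c →
            ∃[ L ] ∃[ Y ] Path G.Adj (inA a) (inA c) L × Image L X Y × (∀ b → b ∈ Y)
  absorbB {a} p a≢c
    with r , R , refl , a∉ , p′ ← Path-uncons p a≢c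
    with b , _ , _ , ab , _ ← neighboursᴮ a
    with b′ , b′≢b , rb′ ← cross-neighbour r b
    with Y , q , allY ← hamiltonianᴮ (≢-sym b′≢b)
    with l , i ← splice ab q (G.Adj-sym rb′) p′ a∉ = _ , Y , l , i , allY

  hamiltonian-AA : ∀ {a₁ a₂} → inA a₁ ≢ inA a₂ → ∃[ L ] Path G.Adj (inA a₁) (inA a₂) L × (∀ w → w ∈ L)
  hamiltonian-AA a₁≢a₂
    with X , p , allX ← hamiltonianᴬ (inA-≢ a₁≢a₂)
    with L , Y , l , i , allY ← absorbB p (inA-≢ a₁≢a₂) = L , l , Image-covers i allX allY

  hamiltonian-AB : ∀ a₁ b₂ → ∃[ L ] Path G.Adj (inA a₁) (inB b₂) L × (∀ w → w ∈ L)
  hamiltonian-AB a₁ b₂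
    with a₂ , a₂≢a₁ , _ ← fourA a₁ a₁ a₁
    with b₁ , b₁≢b₂ , a₂b₁ ← cross-neighbour a₂ b₂
    with X , p , allX ← hamiltonianᴬ (≢-sym a₂≢a₁)
    with Y , q , allY ← hamiltonianᴮ b₁≢b₂ =
    _ , Path-inA-++-inB p q a₂b₁ , Image-covers (Image-inA-++-inB X Y) allX allY

  linkage-AAAA : ∀ {a₁ a₂ a₃ a₄} → Distinct (inA a₁) (inA a₂) (inA a₃) (inA a₄) →
                 Linkage G (inA a₁) (inA a₂) (inA a₃) (inA a₄)
  linkage-AAAA d
    with X , X′ , p , q , dj , cv ← linkableᴬ (Distinct-unmap inA d)
    with L , Y , l , i , allY ← absorbB p (inA-≢ (Distinct.u≢v d)) =
    linkage-of-images l (liftA q) i (Image-inA X′) dj (λ { (_ , ()) }) cv (inj₁ ∘ allY)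

  linkage-AABB : ∀ {a₁ a₂ b₃ b₄} → Distinct (inA a₁) (inA a₂) (inB b₃) (inB b₄) →
                 Linkage G (inA a₁) (inA a₂) (inB b₃) (inB b₄)
  linkage-AABB d
    with X , p , allX ← hamiltonianᴬ (inA-≢ (Distinct.u≢v d))
    with Y , q , allY ← hamiltonianᴮ (inB-≢ (Distinct.x≢y d)) =
    linkage-of-images (liftA p) (liftB q) (Image-inA X) (Image-inB Y)
      (λ { (_ , ()) }) (λ { (() , _) }) (inj₁ ∘ allX) (inj₂ ∘ allY)

  -- The A-part of the second path ends at a fourth vertex z of A and then crosses over to traverse B.
  linkage-AAAB : ∀ {a₁ a₂ a₃ b} → Distinct (inA a₁) (inA a₂) (inA a₃) (inB b) →
                 Linkage G (inA a₁) (inA a₂) (inA a₃) (inB b)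
  linkage-AAAB {a₁} {a₂} {a₃} {b} d
    with z , z≢a₁ , z≢a₂ , z≢a₃ ← fourA a₁ a₂ a₃
    with b′ , b′≢b , zb′ ← cross-neighbour z b
    with X , X′ , p , q , dj , cv ← linkableᴬ (record
           { u≢v = inA-≢ (Distinct.u≢v d) ; u≢x = inA-≢ (Distinct.u≢x d) ; u≢y = ≢-sym z≢a₁
           ; v≢x = inA-≢ (Distinct.v≢x d) ; v≢y = ≢-sym z≢a₂ ; x≢y = ≢-sym z≢a₃ })
    with Y , q′ , allY ← hamiltonianᴮ b′≢b =
    linkage-of-images (liftA p) (Path-inA-++-inB q q′ zb′) (Image-inA X) (Image-inA-++-inB X′ Y)
      dj (λ { (() , _) }) cv (inj₂ ∘ allY)

  linkage-ABAB : CrossMatching P → ∀ {a₁ b₂ a₃ b₄} → Distinct (inA a₁) (inB b₂) (inA a₃) (inB b₄) →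
                 Linkage G (inA a₁) (inB b₂) (inA a₃) (inB b₄)
  linkage-ABAB match d
    with a , a′ , b , b′ , dA , dB , ab , a′b′ ← match (inA-≢ (Distinct.u≢x d)) (inB-≢ (Distinct.v≢y d))
    with X , X′ , p , p′ , djX , cvX ← linkableᴬ dA
    with Y , Y′ , q , q′ , djY , cvY ← linkableᴮ dB =
    linkage-of-images (Path-inA-++-inB p q ab) (Path-inA-++-inB p′ q′ a′b′)
      (Image-inA-++-inB X Y) (Image-inA-++-inB X′ Y′) djX djY cvX cvY

  linkage-inA : ∀ {a₁ a₂ x y} → Distinct (inA a₁) (inA a₂) x y → Linkage G (inA a₁) (inA a₂) x y
  linkage-inA {x = x} {y} d with cover x | cover y
  ... | inj₁ (_ , refl) | inj₁ (_ , refl) = linkage-AAAA d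
  ... | inj₁ (_ , refl) | inj₂ (_ , refl) = linkage-AAAB d
  ... | inj₂ (_ , refl) | inj₁ (_ , refl) = Linkage-reverseʳ G (linkage-AAAB (Distinct-reverseʳ d))
  ... | inj₂ (_ , refl) | inj₂ (_ , refl) = linkage-AABB d

module PartitionLinking {G A B : Graph} (P : Partition G A B) (T : TwoCrossNeighbours P)
  (SA : Spanning A) (SB : Spanning B) (fourA : AtLeastFour A) (fourB : AtLeastFour B) where
  open Partition P
  open PartitionPaths P using (SameSide)
  private
    module ᴬ = CrossLinking P T SA SB fourA
    module ᴮ = CrossLinking (Partition-flip P) (TwoCrossNeighbours-flip T) SB SA fourB

  Partition-hamiltonian : HamiltonianConnected G
  Partition-hamiltonian {u} {v} u≢v with cover u | cover v
  ... | inj₁ (_ , refl) | inj₁ (_ , refl) = ᴬ.hamiltonian-AA u≢v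
  ... | inj₁ (a , refl) | inj₂ (b , refl) = ᴬ.hamiltonian-AB a b
  ... | inj₂ (b , refl) | inj₁ (a , refl) = ᴮ.hamiltonian-AB b a
  ... | inj₂ (_ , refl) | inj₂ (_ , refl) = ᴮ.hamiltonian-AA u≢v

  linkage-sameSide : ∀ {u v x y} → SameSide u v → Distinct u v x y → Linkage G u v x y
  linkage-sameSide (inj₁ (_ , _ , refl , refl)) = ᴬ.linkage-inA
  linkage-sameSide (inj₂ (_ , _ , refl , refl)) = ᴮ.linkage-inA

  linkage-inA-inB : CrossMatching P → ∀ {a b x y} → Distinct (inA a) (inB b) x y → Linkage G (inA a) (inB b) x y
  linkage-inA-inB match {x = x} {y} d with cover x | cover y
  ... | inj₁ (_ , refl) | inj₁ (_ , refl) = Linkage-swap G (ᴬ.linkage-inA (Distinct-swap d))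
  ... | inj₂ (_ , refl) | inj₂ (_ , refl) = Linkage-swap G (ᴮ.linkage-inA (Distinct-swap d))
  ... | inj₁ (_ , refl) | inj₂ (_ , refl) = ᴬ.linkage-ABAB match d
  ... | inj₂ (_ , refl) | inj₁ (_ , refl) = Linkage-reverseʳ G (ᴬ.linkage-ABAB match (Distinct-reverseʳ d))

  Partition-linkable : CrossMatching P → Linkable G
  Partition-linkable match {u} {v} d with cover u | cover v
  ... | inj₁ (_ , refl) | inj₁ (_ , refl) = ᴬ.linkage-inA d
  ... | inj₂ (_ , refl) | inj₂ (_ , refl) = ᴮ.linkage-inA d
  ... | inj₁ (_ , refl) | inj₂ (_ , refl) = linkage-inA-inB match d
  ... | inj₂ (_ , refl) | inj₁ (_ , refl) = Linkage-reverseˡ G (linkage-inA-inB match (Distinct-reverseˡ d))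

-- Adding a universal vertex

Point : Graph
Point = record { V = Unit.⊤ ; Adj = λ _ _ → Empty.⊥ ; Adj-sym = λ () ; _≟_ = λ _ _ → yes refl }

module UniversalVertex {G A : Graph} (P : Partition G A Point)
  (universal : ∀ a → Graph.Adj G (Partition.inB P tt) (Partition.inA P a))
  (SA : Spanning A) (fourA : AtLeastFour A) where
  open Partition P
  open PartitionPaths P
  open Spanning SA renaming (hamiltonian to hamiltonianᴬ; linkable to linkableᴬ)

  w : G.V
  w = inB tt

  all-[tt] : ∀ t → t ∈ [ tt ]
  all-[tt] _ = here refl

  absorb-w : ∀ {a c X} → Path A.Adj a c X → a ≢ c → ∃[ L ] Path G.Adj (inA a) (inA c) L × Image L X [ tt ]
  absorb-w {a} p a≢c with r , R , refl , a∉ , p′ ← Path-uncons p a≢c =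
    _ , splice (G.Adj-sym (universal a)) Path-[ tt ] (universal r) p′ a∉

  hamiltonian-Aw : ∀ a₁ → ∃[ L ] Path G.Adj (inA a₁) w L × (∀ v → v ∈ L)
  hamiltonian-Aw a₁
    with a₂ , a₂≢a₁ , _ ← fourA a₁ a₁ a₁
    with X , p , allX ← hamiltonianᴬ (≢-sym a₂≢a₁) =
    _ , Path-inA-++-inB p Path-[ tt ] (G.Adj-sym (universal a₂)) , Image-covers (Image-inA-++-inB X [ tt ]) allX all-[tt]

  hamiltonian : HamiltonianConnected G
  hamiltonian {u} {v} u≢v with cover u | cover v
  ... | inj₁ (_ , refl) | inj₁ (_ , refl)
    with X , p , allX ← hamiltonianᴬ (inA-≢ u≢v)
    with L , l , i ← absorb-w p (inA-≢ u≢v) = L , l , Image-covers i allX all-[tt]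
  hamiltonian u≢v | inj₁ (a , refl) | inj₂ (_ , refl) = hamiltonian-Aw a
  hamiltonian u≢v | inj₂ (_ , refl) | inj₁ (a , refl) with L , l , allL ← hamiltonian-Aw a =
    reverse L , Path-reverse G.Adj-sym l , Anyₚ.reverse⁺ ∘ allL
  hamiltonian u≢v | inj₂ (_ , refl) | inj₂ (_ , refl) = ⊥-elim (u≢v refl)

  linkage-AAAA : ∀ {a₁ a₂ a₃ a₄} → Distinct (inA a₁) (inA a₂) (inA a₃) (inA a₄) →
                 Linkage G (inA a₁) (inA a₂) (inA a₃) (inA a₄)
  linkage-AAAA d
    with X , X′ , p , q , dj , cv ← linkableᴬ (Distinct-unmap inA d)
    with L , l , i ← absorb-w p (inA-≢ (Distinct.u≢v d)) =
    linkage-of-images l (liftA q) i (Image-inA X′) dj (λ { (_ , ()) }) cv (inj₁ ∘ all-[tt])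

  -- The first path starts at w and enters A at a fourth vertex z of A.
  linkage-wAAA : ∀ {a₂ a₃ a₄} → Distinct w (inA a₂) (inA a₃) (inA a₄) →
                 Linkage G w (inA a₂) (inA a₃) (inA a₄)
  linkage-wAAA {a₂} {a₃} {a₄} d
    with z , z≢a₂ , z≢a₃ , z≢a₄ ← fourA a₂ a₃ a₄
    with X , X′ , p , q , dj , cv ← linkableᴬ (record
           { u≢v = z≢a₂ ; u≢x = z≢a₃ ; u≢y = z≢a₄
           ; v≢x = inA-≢ (Distinct.v≢x d) ; v≢y = inA-≢ (Distinct.v≢y d) ; x≢y = inA-≢ (Distinct.x≢y d) }) =
    linkage-of-images (Path-++ (liftB Path-[ tt ]) (liftA p) (universal z) (inA-inB-disjoint X [ tt ] ∘ Product.swap))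
      (liftA q) (Image-inB-++-inA [ tt ] X) (Image-inA X′) dj (λ { (_ , ()) }) cv (inj₁ ∘ all-[tt])

  linkable : Linkable G
  linkable {u} {v} {x} {y} d with cover u | cover v | cover x | cover y
  ... | inj₁ (_ , refl) | inj₁ (_ , refl) | inj₁ (_ , refl) | inj₁ (_ , refl) = linkage-AAAA d
  ... | inj₂ (_ , refl) | inj₁ (_ , refl) | inj₁ (_ , refl) | inj₁ (_ , refl) = linkage-wAAA d
  ... | inj₁ (_ , refl) | inj₂ (_ , refl) | inj₁ (_ , refl) | inj₁ (_ , refl) =
    Linkage-reverseˡ G (linkage-wAAA (Distinct-reverseˡ d))
  ... | inj₁ (_ , refl) | inj₁ (_ , refl) | inj₂ (_ , refl) | inj₁ (_ , refl) =
    Linkage-swap G (linkage-wAAA (Distinct-swap d))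
  ... | inj₁ (_ , refl) | inj₁ (_ , refl) | inj₁ (_ , refl) | inj₂ (_ , refl) =
    Linkage-reverseʳ G (Linkage-swap G (linkage-wAAA (Distinct-swap (Distinct-reverseʳ d))))
  ... | inj₂ (_ , refl) | inj₂ (_ , refl) | _ | _ = ⊥-elim (Distinct.u≢v d refl)
  ... | inj₂ (_ , refl) | inj₁ _ | inj₂ (_ , refl) | _ = ⊥-elim (Distinct.u≢x d refl)
  ... | inj₂ (_ , refl) | inj₁ _ | inj₁ _ | inj₂ (_ , refl) = ⊥-elim (Distinct.u≢y d refl)
  ... | inj₁ _ | inj₂ (_ , refl) | inj₂ (_ , refl) | _ = ⊥-elim (Distinct.v≢x d refl)
  ... | inj₁ _ | inj₂ (_ , refl) | inj₁ _ | inj₂ (_ , refl) = ⊥-elim (Distinct.v≢y d refl)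
  ... | inj₁ _ | inj₁ _ | inj₂ (_ , refl) | inj₂ (_ , refl) = ⊥-elim (Distinct.x≢y d refl)

  UniversalVertex-spanning : Spanning G
  UniversalVertex-spanning = record { hamiltonian = hamiltonian ; linkable = linkable }

-- Exhaustive search in small graphs

module ExhaustiveSearch (G : Graph) (Adj? : Decidable (Graph.Adj G)) (vertices : List (Graph.V G))
  (complete : ∀ v → v ∈ vertices) where
  open Graph G
  open import Data.List.Membership.DecPropositional _≟_ using (_∈?_)

  insertions : V → List V → List (List V)
  insertions x []       = [ [ x ] ]
  insertions x (y ∷ ys) = (x ∷ y ∷ ys) ∷ map (y ∷_) (insertions x ys)

  permutations : List V → List (List V)
  permutations []       = [ [] ]
  permutations (x ∷ xs) = concatMap (insertions x) (permutations xs)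

  others : List V → List V
  others F = filter (λ w → ¬? (w ∈? F)) vertices

  isPath? : ∀ xs → Dec (IsPath Adj xs)
  isPath? xs = Linked.linked? Adj? xs ×-dec AllPairs.allPairs? (λ a b → ¬? (a ≟ b)) xs

  SpanningPaths : V → V → V → V → List V × List V → Set
  SpanningPaths u v x y (s , t) =
    IsPath Adj ((u ∷ s) ∷ʳ v) × IsPath Adj ((x ∷ t) ∷ʳ y) ×
    All (_∉ (x ∷ t) ∷ʳ y) ((u ∷ s) ∷ʳ v) × All (λ w → w ∈ (u ∷ s) ∷ʳ v ⊎ w ∈ (x ∷ t) ∷ʳ y) vertices

  spanningPaths? : ∀ u v x y st → Dec (SpanningPaths u v x y st)
  spanningPaths? u v x y (s , t) = isPath? _ ×-dec isPath? _ ×-dec All.all? (λ w → ¬? (w ∈? _)) _ ×-dec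
    All.all? (λ w → (w ∈? _) ⊎-dec (w ∈? _)) vertices

  candidates : V → V → V → V → List (List V × List V)
  candidates u v x y = concatMap (λ p → zip (inits p) (tails p)) (permutations (others (u ∷ v ∷ x ∷ y ∷ [])))

  AllLinkages : Set
  AllLinkages = All (λ u → All (λ v → All (λ x → All (λ y →
    u ≢ v × u ≢ x × u ≢ y × v ≢ x × v ≢ y × x ≢ y → Any (SpanningPaths u v x y) (candidates u v x y))
    vertices) vertices) vertices) vertices

  allLinkages? : Dec AllLinkages
  allLinkages? = All.all? (λ u → All.all? (λ v → All.all? (λ x → All.all? (λ y →
    (¬? (u ≟ v) ×-dec ¬? (u ≟ x) ×-dec ¬? (u ≟ y) ×-dec ¬? (v ≟ x) ×-dec ¬? (v ≟ y) ×-dec ¬? (x ≟ y))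
      →-dec Any.any? (spanningPaths? u v x y) (candidates u v x y))
    vertices) vertices) vertices) vertices

  AllLinkages⇒Linkable : AllLinkages → Linkable G
  AllLinkages⇒Linkable all {u} {v} {x} {y} d
    with (s , t) , p , q , dj , cv ← Any.satisfied
           (All.lookup (All.lookup (All.lookup (All.lookup all (complete u)) (complete v)) (complete x)) (complete y)
             (Distinct.u≢v d , Distinct.u≢x d , Distinct.u≢y d , Distinct.v≢x d , Distinct.v≢y d , Distinct.x≢y d)) =
    _ , _ , (Ends-∷ʳ s , p) , (Ends-∷ʳ t , q) , (λ (m , n) → All.lookup dj m n) , All.lookup cv ∘ complete

  AllHamiltonianPaths : Set
  AllHamiltonianPaths = All (λ a → All (λ b → a ≢ b →
    Any (λ s → IsPath Adj ((a ∷ s) ∷ʳ b) × All (_∈ (a ∷ s) ∷ʳ b) vertices)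
        (permutations (others (a ∷ b ∷ [])))) vertices) vertices

  allHamiltonianPaths? : Dec AllHamiltonianPaths
  allHamiltonianPaths? = All.all? (λ a → All.all? (λ b → ¬? (a ≟ b) →-dec
    Any.any? (λ s → isPath? _ ×-dec All.all? (_∈? _) vertices) (permutations (others (a ∷ b ∷ [])))) vertices) vertices

  AllHamiltonianPaths⇒HamiltonianConnected : AllHamiltonianPaths → HamiltonianConnected G
  AllHamiltonianPaths⇒HamiltonianConnected all {a} {b} a≢b
    with s , p , cv ← Any.satisfied (All.lookup (All.lookup all (complete a)) (complete b) a≢b) =
    _ , (Ends-∷ʳ s , p) , All.lookup cv ∘ complete

  spanning-by-search : {_ : True allHamiltonianPaths?} {_ : True allLinkages?} → Spanning G
  spanning-by-search {h} {l} = record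
    { hamiltonian = AllHamiltonianPaths⇒HamiltonianConnected (toWitness h)
    ; linkable    = AllLinkages⇒Linkable (toWitness l) }

∣insertAt-true∣ : ∀ {m} (s : Subset m) e → ∣ insertAt s e true ∣ ≡ suc ∣ s ∣
∣insertAt-true∣ s           zero    = refl
∣insertAt-true∣ (true ∷ s)  (suc e) = cong suc (∣insertAt-true∣ s e)
∣insertAt-true∣ (false ∷ s) (suc e) = ∣insertAt-true∣ s e

∣insertAt-false∣ : ∀ {m} (s : Subset m) e → ∣ insertAt s e false ∣ ≡ ∣ s ∣
∣insertAt-false∣ s           zero    = refl
∣insertAt-false∣ (true ∷ s)  (suc e) = cong suc (∣insertAt-false∣ s e)
∣insertAt-false∣ (false ∷ s) (suc e) = ∣insertAt-false∣ s e

insertAt-∩ : ∀ {m} (s t : Subset m) e b c → insertAt s e b ∩ insertAt t e c ≡ insertAt (s ∩ t) e (b ∧ c)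
insertAt-∩ s       t       zero    b c = refl
insertAt-∩ (x ∷ s) (y ∷ t) (suc e) b c = cong ((x ∧ y) ∷_) (insertAt-∩ s t e b c)

insertAt-injective : ∀ {m} {s t : Subset m} e b → insertAt s e b ≡ insertAt t e b → s ≡ t
insertAt-injective {s = s} {t} e b eq =
  trans (sym (Vec.removeAt-insertAt s e b)) (trans (cong (λ z → removeAt z e) eq) (Vec.removeAt-insertAt t e b))

insertAt-true≢false : ∀ {m} (s t : Subset m) e → insertAt s e true ≢ insertAt t e false
insertAt-true≢false s t e eq
  with () ← trans (sym (Vec.insertAt-lookup s e true)) (trans (cong (λ z → lookup z e) eq) (Vec.insertAt-lookup t e false))

∣[]≔true∣ : ∀ {m} (s : Subset m) f → lookup s f ≡ false → ∣ s [ f ]≔ true ∣ ≡ suc ∣ s ∣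
∣[]≔true∣ (false ∷ s) zero    _ = refl
∣[]≔true∣ (true ∷ s)  (suc f) p = cong suc (∣[]≔true∣ s f p)
∣[]≔true∣ (false ∷ s) (suc f) p = ∣[]≔true∣ s f p

∣[]≔false∣ : ∀ {m} (s : Subset m) f → lookup s f ≡ true → suc ∣ s [ f ]≔ false ∣ ≡ ∣ s ∣
∣[]≔false∣ (true ∷ s)  zero    _ = refl
∣[]≔false∣ (true ∷ s)  (suc f) p = cong suc (∣[]≔false∣ s f p)
∣[]≔false∣ (false ∷ s) (suc f) p = ∣[]≔false∣ s f p

∩-[]≔true : ∀ {m} (s : Subset m) f → s ∩ (s [ f ]≔ true) ≡ s
∩-[]≔true (true ∷ s)  zero    = cong (true ∷_) (Subset.∩-idem s)
∩-[]≔true (false ∷ s) zero    = cong (false ∷_) (Subset.∩-idem s)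
∩-[]≔true (x ∷ s)     (suc f) = cong₂ _∷_ (Bool.∧-idem x) (∩-[]≔true s f)

[]≔false-∩ : ∀ {m} (s : Subset m) f → (s [ f ]≔ false) ∩ s ≡ s [ f ]≔ false
[]≔false-∩ (x ∷ s) zero    = cong (false ∷_) (Subset.∩-idem s)
[]≔false-∩ (x ∷ s) (suc f) = cong₂ _∷_ (Bool.∧-idem x) ([]≔false-∩ s f)

[]≔-≢ : ∀ {m} (s : Subset m) {f g} b → f ≢ g → lookup s f ≡ not b → s [ f ]≔ b ≢ s [ g ]≔ b
[]≔-≢ s {f} b f≢g s[f] eq =
  Bool.not-¬ refl (trans (sym (Vec.lookup∘update f s b))
    (trans (cong (λ t → lookup t f) eq) (trans (Vec.lookup∘update′ f≢g s b) s[f])))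

member : ∀ {m} (s : Subset m) → 1 ≤ ∣ s ∣ → ∃[ f ] lookup s f ≡ true
member (true ∷ s)  _ = zero , refl
member (false ∷ s) p with f , s[f] ← member s p = suc f , s[f]

two-members : ∀ {m} (s : Subset m) → 2 ≤ ∣ s ∣ → ∃[ f ] ∃[ g ] f ≢ g × lookup s f ≡ true × lookup s g ≡ true
two-members (true ∷ s) (s≤s p) with g , s[g] ← member s p = zero , suc g , (λ ()) , refl , s[g]
two-members (false ∷ s) p with f , g , f≢g , s[f] , s[g] ← two-members s p =
  suc f , suc g , f≢g ∘ Fin.suc-injective , s[f] , s[g]

two-non-members : ∀ {m} (s : Subset m) → 2 + ∣ s ∣ ≤ m →
                  ∃[ f ] ∃[ g ] f ≢ g × lookup s f ≡ false × lookup s g ≡ false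
two-non-members {m} s p
  with f , g , f≢g , ∁s[f] , ∁s[g] ← two-members (∁ s) (subst (2 ≤_) (sym (Subset.∣∁p∣≡n∸∣p∣ s))
                                       (subst (_≤ m ∸ ∣ s ∣) (ℕ.m+n∸n≡m 2 ∣ s ∣) (ℕ.∸-monoˡ-≤ ∣ s ∣ p))) =
  f , g , f≢g , Bool.not-injective (trans (sym (Vec.lookup-map f not s)) ∁s[f]) ,
  Bool.not-injective (trans (sym (Vec.lookup-map g not s)) ∁s[g])

agree-or-complement : ∀ {n} (s t : Subset n) → (∃[ e ] lookup s e ≡ lookup t e) ⊎ t ≡ ∁ s
agree-or-complement []          []          = inj₂ refl
agree-or-complement (true ∷ s)  (true ∷ t)  = inj₁ (zero , refl)
agree-or-complement (false ∷ s) (false ∷ t) = inj₁ (zero , refl)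
agree-or-complement (true ∷ s)  (false ∷ t) with agree-or-complement s t
... | inj₁ (e , eq) = inj₁ (suc e , eq)
... | inj₂ eq       = inj₂ (cong (false ∷_) eq)
agree-or-complement (false ∷ s) (true ∷ t) with agree-or-complement s t
... | inj₁ (e , eq) = inj₁ (suc e , eq)
... | inj₂ eq       = inj₂ (cong (true ∷_) eq)

∣p∣≡0⇒p≡⊥ : ∀ {n} (s : Subset n) → ∣ s ∣ ≡ 0 → s ≡ ⊥
∣p∣≡0⇒p≡⊥ []          _ = refl
∣p∣≡0⇒p≡⊥ (false ∷ s) p = cong (false ∷_) (∣p∣≡0⇒p≡⊥ s p)

-- The Johnson graph and its splitting along an element e

JVertex-≡ : ∀ {n k} {v w : JVertex n k} → proj₁ v ≡ proj₁ w → v ≡ w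
JVertex-≡ {v = s , p} {w = .s , q} refl = cong (s ,_) (ℕ.≡-irrelevant p q)

J : ℕ → ℕ → Graph
J n k = record
  { V = JVertex n k
  ; Adj = JAdj n k
  ; Adj-sym = λ {v} {w} → trans (cong ∣_∣ (Subset.∩-comm (proj₁ w) (proj₁ v)))
  ; _≟_ = λ v w → Dec.map′ JVertex-≡ (cong proj₁) (Vec.≡-dec Bool._≟_ (proj₁ v) (proj₁ w)) }
  where import Relation.Nullary.Decidable as Dec

module _ {m : ℕ} (e : Fin (suc m)) where

  including : ∀ {j} → JVertex m j → JVertex (suc m) (suc j)
  including (s , p) = insertAt s e true , trans (∣insertAt-true∣ s e) (cong suc p)

  excluding : ∀ {j} → JVertex m j → JVertex (suc m) j
  excluding (s , p) = insertAt s e false , trans (∣insertAt-false∣ s e) p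

  including-injective : ∀ {j} {v w : JVertex m j} → including v ≡ including w → v ≡ w
  including-injective = JVertex-≡ ∘ insertAt-injective e true ∘ cong proj₁

  excluding-injective : ∀ {j} {v w : JVertex m j} → excluding v ≡ excluding w → v ≡ w
  excluding-injective = JVertex-≡ ∘ insertAt-injective e false ∘ cong proj₁

  including≢excluding : ∀ {j} (v : JVertex m j) (w : JVertex m (suc j)) → including v ≢ excluding w
  including≢excluding (s , _) (t , _) = insertAt-true≢false s t e ∘ cong proj₁

  including-Adj : ∀ {j} {v w : JVertex m (suc j)} → JAdj m (suc j) v w →
                  JAdj (suc m) (suc (suc j)) (including v) (including w)
  including-Adj {v = s , _} {t , _} p =
    trans (cong ∣_∣ (insertAt-∩ s t e true true)) (trans (∣insertAt-true∣ (s ∩ t) e) (cong suc p))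

  excluding-Adj : ∀ {j} {v w : JVertex m j} → JAdj m j v w → JAdj (suc m) j (excluding v) (excluding w)
  excluding-Adj {v = s , _} {t , _} p =
    trans (cong ∣_∣ (insertAt-∩ s t e false false)) (trans (∣insertAt-false∣ (s ∩ t) e) p)

  including-excluding-Adj : ∀ {j} (v : JVertex m j) (w : JVertex m (suc j)) → ∣ proj₁ v ∩ proj₁ w ∣ ≡ j →
                            JAdj (suc m) (suc j) (including v) (excluding w)
  including-excluding-Adj (s , _) (t , _) p =
    trans (cong ∣_∣ (insertAt-∩ s t e true false)) (trans (∣insertAt-false∣ (s ∩ t) e) p)

  ∈⇒including : ∀ {j} (v : JVertex (suc m) (suc j)) → lookup (proj₁ v) e ≡ true →
                ∃[ w ] including {j} w ≡ v
  ∈⇒including (s , p) s[e] =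
    (removeAt s e , ℕ.suc-injective (trans (sym (∣insertAt-true∣ _ e)) (trans (cong ∣_∣ eq) p))) , JVertex-≡ eq
    where eq = trans (cong (insertAt (removeAt s e) e) (sym s[e])) (Vec.insertAt-removeAt s e)

  ∉⇒excluding : ∀ {j} (v : JVertex (suc m) j) → lookup (proj₁ v) e ≡ false →
                ∃[ w ] excluding {j} w ≡ v
  ∉⇒excluding (s , p) s[e] =
    (removeAt s e , trans (sym (∣insertAt-false∣ _ e)) (trans (cong ∣_∣ eq) p)) , JVertex-≡ eq
    where eq = trans (cong (insertAt (removeAt s e) e) (sym s[e])) (Vec.insertAt-removeAt s e)

Johnson-split : ∀ m j (e : Fin (suc m)) → Partition (J (suc m) (suc (suc j))) (J m (suc j)) (J m (suc (suc j)))
Johnson-split m j e = record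
  { inA = including e ; inB = excluding e
  ; inA-injective = including-injective e ; inB-injective = excluding-injective e
  ; inA-Adj = λ {a} {a′} → including-Adj e {v = a} {a′} ; inB-Adj = λ {b} {b′} → excluding-Adj e {v = b} {b′}
  ; inA≢inB = including≢excluding e
  ; cover = cover }
  where
  cover : ∀ v → (∃[ a ] including e a ≡ v) ⊎ (∃[ b ] excluding e b ≡ v)
  cover v with lookup (proj₁ v) e in v[e]
  ... | true  = inj₁ (∈⇒including e v v[e])
  ... | false = inj₂ (∉⇒excluding e v v[e])

Johnson-split-sameSide : ∀ {m j} e (u v : JVertex (suc m) (suc (suc j))) → lookup (proj₁ u) e ≡ lookup (proj₁ v) e →
                         PartitionPaths.SameSide (Johnson-split m j e) u v
Johnson-split-sameSide e u v eq with lookup (proj₁ u) e in u[e]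
... | true  = inj₁ (proj₁ (∈⇒including e u u[e]) , proj₁ (∈⇒including e v (sym eq)) ,
                    proj₂ (∈⇒including e u u[e]) , proj₂ (∈⇒including e v (sym eq)))
... | false = inj₂ (proj₁ (∉⇒excluding e u u[e]) , proj₁ (∉⇒excluding e v (sym eq)) ,
                    proj₂ (∉⇒excluding e u u[e]) , proj₂ (∉⇒excluding e v (sym eq)))

Johnson-split-neighbours : ∀ {m j} e → 2 + j < m → TwoCrossNeighbours (Johnson-split m j e)
Johnson-split-neighbours {m} {j} e j<m = record { neighboursᴮ = up ; neighboursᴬ = down }
  where
  module G = Graph (J (suc m) (suc (suc j)))
  up : ∀ a → ∃[ b ] ∃[ b′ ] b ≢ b′ × G.Adj (including e a) (excluding e b) × G.Adj (including e a) (excluding e b′)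
  up (s , p) with f , g , f≢g , s[f] , s[g] ← two-non-members s (subst (λ z → 2 + z ≤ m) (sym p) j<m) =
    b f s[f] , b g s[g] , []≔-≢ s true f≢g s[f] ∘ cong proj₁ , adj f s[f] , adj g s[g]
    where
    b : ∀ h → lookup s h ≡ false → JVertex m (suc (suc j))
    b h s[h] = s [ h ]≔ true , trans (∣[]≔true∣ s h s[h]) (cong suc p)
    adj : ∀ h s[h] → G.Adj (including e (s , p)) (excluding e (b h s[h]))
    adj h s[h] = including-excluding-Adj e (s , p) (b h s[h]) (trans (cong ∣_∣ (∩-[]≔true s h)) p)
  down : ∀ b → ∃[ a ] ∃[ a′ ] a ≢ a′ × G.Adj (excluding e b) (including e a) × G.Adj (excluding e b) (including e a′)
  down (t , q) with f , g , f≢g , t[f] , t[g] ← two-members t (subst (2 ≤_) (sym q) (s≤s (s≤s z≤n))) =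
    a f t[f] , a g t[g] , []≔-≢ t false f≢g t[f] ∘ cong proj₁ , adj f t[f] , adj g t[g]
    where
    size : ∀ h → lookup t h ≡ true → ∣ t [ h ]≔ false ∣ ≡ suc j
    size h t[h] = ℕ.suc-injective (trans (∣[]≔false∣ t h t[h]) q)
    a : ∀ h → lookup t h ≡ true → JVertex m (suc j)
    a h t[h] = t [ h ]≔ false , size h t[h]
    adj : ∀ h t[h] → G.Adj (excluding e (t , q)) (including e (a h t[h]))
    adj h t[h] = G.Adj-sym {including e (a h t[h])} {excluding e (t , q)}
      (including-excluding-Adj e (a h t[h]) (t , q) (trans (cong ∣_∣ ([]≔false-∩ t h)) (size h t[h])))

vertices : ∀ m j → List (JVertex m j)
vertices zero    zero    = [ [] , refl ]
vertices zero    (suc j) = []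
vertices (suc m) zero    = map (excluding zero) (vertices m zero)
vertices (suc m) (suc j) = map (including zero) (vertices m j) ++ map (excluding zero) (vertices m (suc j))

vertices-complete : ∀ m j (v : JVertex m j) → v ∈ vertices m j
vertices-complete zero    zero    ([] , refl) = here refl
vertices-complete (suc m) zero    (false ∷ s , p) = ∈-map⁺ (excluding zero) (vertices-complete m zero (s , p))
vertices-complete (suc m) (suc j) (true ∷ s , p) =
  subst (_∈ vertices (suc m) (suc j)) (JVertex-≡ refl)
    (∈-++⁺ˡ (∈-map⁺ (including zero) (vertices-complete m j (s , ℕ.suc-injective p))))
vertices-complete (suc m) (suc j) (false ∷ s , p) =
  ∈-++⁺ʳ (map (including zero) (vertices m j)) (∈-map⁺ (excluding zero) (vertices-complete m (suc j) (s , p)))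

vertices-unique : ∀ m j → Unique (vertices m j)
vertices-unique zero    zero    = [] ∷ []
vertices-unique zero    (suc j) = []
vertices-unique (suc m) zero    = Unique.map⁺ (excluding-injective zero) (vertices-unique m zero)
vertices-unique (suc m) (suc j) =
  Unique.++⁺ (Unique.map⁺ (including-injective zero) (vertices-unique m j))
             (Unique.map⁺ (excluding-injective zero) (vertices-unique m (suc j)))
             λ (m₁ , m₂) → case ∈-map⁻ (including zero) m₁ , ∈-map⁻ (excluding zero) m₂ of λ
               { ((v , _ , refl) , (w , _ , eq)) → including≢excluding zero v w eq }

length-vertices-suc : ∀ m j → length (vertices (suc m) (suc j)) ≡ length (vertices m j) + length (vertices m (suc j))
length-vertices-suc m j = trans (length-++ (map (including zero) (vertices m j)))
  (cong₂ _+_ (length-map (including zero) (vertices m j)) (length-map (excluding zero) (vertices m (suc j))))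

1≤length-vertices : ∀ m j → j ≤ m → 1 ≤ length (vertices m j)
1≤length-vertices zero    zero    _ = s≤s z≤n
1≤length-vertices (suc m) zero    _ =
  subst (1 ≤_) (sym (length-map (excluding zero) (vertices m zero))) (1≤length-vertices m zero z≤n)
1≤length-vertices (suc m) (suc j) (s≤s j≤m) rewrite length-vertices-suc m j =
  ℕ.≤-trans (1≤length-vertices m j j≤m) (ℕ.m≤m+n _ _)

m≤length-vertices₁ : ∀ m → m ≤ length (vertices m 1)
m≤length-vertices₁ zero    = z≤n
m≤length-vertices₁ (suc m) rewrite length-vertices-suc m 0 =
  ℕ.+-mono-≤ (1≤length-vertices m 0 z≤n) (m≤length-vertices₁ m)

m≤length-vertices : ∀ m j → 1 ≤ j → j < m → m ≤ length (vertices m j)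
m≤length-vertices m       (suc zero)    _ _         = m≤length-vertices₁ m
m≤length-vertices (suc m) (suc (suc j)) _ (s≤s j<m) rewrite length-vertices-suc m (suc j) =
  subst (_≤ length (vertices m (suc j)) + length (vertices m (suc (suc j)))) (ℕ.+-comm m 1)
    (ℕ.+-mono-≤ (m≤length-vertices m (suc j) (s≤s z≤n) j<m) (1≤length-vertices m (suc (suc j)) j<m))

6≤length-vertices : ∀ j → 6 ≤ length (vertices (suc (suc j) + suc (suc j)) (suc (suc j)))
6≤length-vertices j rewrite length-vertices-suc (suc j + suc (suc j)) (suc j) =
  ℕ.+-mono-≤
    (ℕ.≤-trans 3≤M (m≤length-vertices M (suc j) (s≤s z≤n) (s≤s (ℕ.≤-trans (ℕ.n≤1+n _) 2+j≤M′))))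
    (ℕ.≤-trans 3≤M (m≤length-vertices M (suc (suc j)) (s≤s z≤n) (s≤s 2+j≤M′)))
  where
  M = suc j + suc (suc j)
  2+j≤M′ : suc (suc j) ≤ j + suc (suc j)
  2+j≤M′ = ℕ.m≤n+m (suc (suc j)) j
  3≤M : 3 ≤ M
  3≤M = s≤s (ℕ.≤-trans (s≤s (s≤s z≤n)) 2+j≤M′)

J-atLeastFour : ∀ {m j} → 4 ≤ m → 1 ≤ j → j < m → AtLeastFour (J m j)
J-atLeastFour {m} {j} 4≤m 1≤j j<m a b c
  with d , _ , d∉ ← ∃-∉-longer (Graph._≟_ (J m j)) {F = a ∷ b ∷ c ∷ []} (vertices-unique m j)
                           (ℕ.≤-trans 4≤m (m≤length-vertices m j 1≤j j<m))
  = d , d∉ ∘ here , d∉ ∘ there ∘ here , d∉ ∘ there ∘ there ∘ here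

-- The cross edges join false ∷ r in the first part to true ∷ r in the second, for two sets r that differ
-- from the tails of all four terminals.
Johnson-split-matching : ∀ {m j} → 6 ≤ length (vertices m (suc j)) → CrossMatching (Johnson-split (suc m) j zero)
Johnson-split-matching {m} {j} six {a₁} {a₂} {b₁} {b₂} a₁≢a₂ b₁≢b₂
  with r , r′ , r∈ , r′∈ , r∉ , r′∉ ← ∃₂-∉-longer (Vec.≡-dec Bool._≟_)
         {F = tail (proj₁ a₁) ∷ tail (proj₁ a₂) ∷ tail (proj₁ b₁) ∷ tail (proj₁ b₂) ∷ []}
         (Unique.map⁺ JVertex-≡ (vertices-unique m (suc j)))
         (subst (6 ≤_) (sym (length-map proj₁ (vertices m (suc j)))) six)
  = (false ∷ r , size r∈) , (false ∷ r′ , size r′∈) ,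
    (true ∷ r , cong suc (size r∈)) , (true ∷ r′ , cong suc (size r′∈)) ,
    record { u≢v = λ eq → r∉ (here (sym (trace eq))) ; u≢x = a₁≢a₂
           ; u≢y = λ eq → r′∉ (there (here (sym (trace eq))))
           ; v≢x = λ eq → r∉ (there (here (trace eq))) ; v≢y = λ eq → r′∉ (here (sym (trace eq)))
           ; x≢y = λ eq → r′∉ (there (there (here (sym (trace eq))))) } ,
    record { u≢v = λ eq → r∉ (there (there (here (trace eq)))) ; u≢x = λ eq → r′∉ (here (sym (trace eq)))
           ; u≢y = λ eq → r∉ (there (there (there (here (trace eq)))))
           ; v≢x = λ eq → r′∉ (there (there (there (here (sym (trace eq))))))
           ; v≢y = b₁≢b₂ ; x≢y = λ eq → r′∉ (there (there (there (there (here (trace eq)))))) } ,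
    trans (cong ∣_∣ (Subset.∩-idem r)) (size r∈) , trans (cong ∣_∣ (Subset.∩-idem r′)) (size r′∈)
  where
  size : ∀ {r} → r ∈ map proj₁ (vertices m (suc j)) → ∣ r ∣ ≡ suc j
  size r∈ with (_ , p) , _ , refl ← ∈-map⁻ proj₁ r∈ = p
  trace : ∀ {k} {v w : JVertex (suc m) k} → v ≡ w → tail (proj₁ v) ≡ tail (proj₁ w)
  trace = cong (tail ∘ proj₁)

complement-sizes : ∀ {n k} (u v : JVertex n k) → proj₁ v ≡ ∁ (proj₁ u) → k + k ≡ n
complement-sizes {n} {k} (s , p) (t , q) t≡∁s = begin
  k + k              ≡⟨ cong (_+ k) k≡n∸k ⟩
  n ∸ k + k          ≡⟨ ℕ.m∸n+n≡m (subst (_≤ n) p (Subset.∣p∣≤n s)) ⟩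
  n                  ∎
  where
  open ≡-Reasoning
  k≡n∸k : k ≡ n ∸ k
  k≡n∸k = begin
    k         ≡⟨ sym q ⟩
    ∣ t ∣     ≡⟨ cong ∣_∣ t≡∁s ⟩
    ∣ ∁ s ∣   ≡⟨ Subset.∣∁p∣≡n∸∣p∣ s ⟩
    n ∸ ∣ s ∣ ≡⟨ cong (n ∸_) p ⟩
    n ∸ k     ∎

Johnson-split-complementary : ∀ m j → 4 ≤ m → suc (suc j) + suc (suc j) ≡ suc m →
                              CrossMatching (Johnson-split m j zero)
Johnson-split-complementary .3 zero (s≤s (s≤s (s≤s ()))) refl
Johnson-split-complementary m (suc j) _ 2k≡1+m
  with refl ← trans (sym (ℕ.suc-injective 2k≡1+m)) (ℕ.+-suc (suc (suc j)) (suc (suc j))) =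
  Johnson-split-matching (6≤length-vertices j)

Johnson-split-spanning : ∀ m j → 4 ≤ m → 2 + j < m → Spanning (J m (suc j)) → Spanning (J m (suc (suc j))) →
                         Spanning (J (suc m) (suc (suc j)))
Johnson-split-spanning m j 4≤m 2+j<m SA SB = record { hamiltonian = L.Partition-hamiltonian zero ; linkable = linkable }
  where
  module L (e : Fin (suc m)) = PartitionLinking (Johnson-split m j e) (Johnson-split-neighbours e 2+j<m) SA SB
    (J-atLeastFour 4≤m (s≤s z≤n) (ℕ.<-trans (ℕ.n<1+n _) 2+j<m)) (J-atLeastFour 4≤m (s≤s z≤n) 2+j<m)
  linkable : Linkable (J (suc m) (suc (suc j)))
  linkable {u} {v} {x} {y} d with agree-or-complement (proj₁ u) (proj₁ v) | agree-or-complement (proj₁ x) (proj₁ y)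
  ... | inj₁ (e , eq) | _ = L.linkage-sameSide e (Johnson-split-sameSide e u v eq) d
  ... | inj₂ _ | inj₁ (e , eq) =
    Linkage-swap (J (suc m) (suc (suc j))) (L.linkage-sameSide e (Johnson-split-sameSide e x y eq) (Distinct-swap d))
  ... | inj₂ v≡∁u | inj₂ _ =
    L.Partition-linkable zero (Johnson-split-complementary m j 4≤m (complement-sizes u v v≡∁u)) d

-- J(m+1, 1) is J(m, 1) plus the universal vertex {0}.
Johnson-spanning-k=1 : ∀ m → 4 ≤ m → Spanning (J m 1) → Spanning (J (suc m) 1)
Johnson-spanning-k=1 m 4≤m S =
  UniversalVertex-spanning P universal S (J-atLeastFour 4≤m (s≤s z≤n) (ℕ.<-≤-trans (s≤s (s≤s z≤n)) 4≤m))
  where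
  open UniversalVertex using (UniversalVertex-spanning)
  singleton : JVertex (suc m) 1
  singleton = true ∷ ⊥ , cong suc (Subset.∣⊥∣≡0 m)
  P : Partition (J (suc m) 1) (J m 1) Point
  P = record
    { inA = excluding zero ; inB = λ _ → singleton
    ; inA-injective = excluding-injective zero ; inB-injective = λ _ → refl
    ; inA-Adj = λ {a} {a′} → excluding-Adj zero {v = a} {a′} ; inB-Adj = λ ()
    ; inA≢inB = λ _ _ → (λ ()) ∘ Vec.∷-injectiveˡ ∘ cong proj₁
    ; cover = λ { (true ∷ s , p) →
                    inj₂ (_ , JVertex-≡ (cong (true ∷_) (sym (∣p∣≡0⇒p≡⊥ s (ℕ.suc-injective p)))))
                ; (false ∷ s , p) → inj₁ ((s , p) , refl) } }
  universal : ∀ a → JAdj (suc m) 1 singleton (excluding zero a)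
  universal (s , _) = trans (cong ∣_∣ (Subset.∩-zeroˡ s)) (Subset.∣⊥∣≡0 m)

-- J(j+3, j+2) is J(j+2, j+1) plus the universal vertex [j+3] ∖ {0}.
Johnson-spanning-k=n-1 : ∀ j → 4 ≤ suc (suc j) → Spanning (J (suc (suc j)) (suc j)) →
                         Spanning (J (suc (suc (suc j))) (suc (suc j)))
Johnson-spanning-k=n-1 j 4≤m S = UniversalVertex-spanning P universal S (J-atLeastFour 4≤m (s≤s z≤n) (ℕ.n<1+n _))
  where
  open UniversalVertex using (UniversalVertex-spanning)
  m = suc (suc j)
  co-singleton : JVertex (suc m) m
  co-singleton = false ∷ ⊤ , Subset.∣⊤∣≡n m
  P : Partition (J (suc m) m) (J m (suc j)) Point
  P = record
    { inA = including zero ; inB = λ _ → co-singleton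
    ; inA-injective = including-injective zero ; inB-injective = λ _ → refl
    ; inA-Adj = λ {a} {a′} → including-Adj zero {v = a} {a′} ; inB-Adj = λ ()
    ; inA≢inB = λ _ _ → (λ ()) ∘ Vec.∷-injectiveˡ ∘ cong proj₁
    ; cover = λ { (true ∷ s , p) → inj₁ ((s , ℕ.suc-injective p) , JVertex-≡ refl)
                ; (false ∷ s , p) → inj₂ (_ , JVertex-≡ (cong (false ∷_) (sym (Subset.∣p∣≡n⇒p≡⊤ p)))) } }
  universal : ∀ a → JAdj (suc m) m co-singleton (including zero a)
  universal (s , p) = trans (cong ∣_∣ (Subset.∩-identityˡ s)) p

JAdj? : ∀ n k → Decidable (JAdj n k)
JAdj? n k v w = ∣ proj₁ v ∩ proj₁ w ∣ ℕ.≟ k ∸ 1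

module J4-search (k : ℕ) = ExhaustiveSearch (J 4 k) (JAdj? 4 k) (vertices 4 k) (vertices-complete 4 k)

J4-spanning : ∀ k → 1 ≤ k → k < 4 → Spanning (J 4 k)
J4-spanning 1 _ _ = J4-search.spanning-by-search 1
J4-spanning 2 _ _ = J4-search.spanning-by-search 2
J4-spanning 3 _ _ = J4-search.spanning-by-search 3
J4-spanning (suc (suc (suc (suc _)))) _ (s≤s (s≤s (s≤s (s≤s ()))))

Johnson-spanning : ∀ r k → 1 ≤ k → k < 4 + r → Spanning (J (4 + r) k)
Johnson-spanning zero    k             1≤k k<4 = J4-spanning k 1≤k k<4
Johnson-spanning (suc r) 1             _   _   =
  Johnson-spanning-k=1 (4 + r) (ℕ.m≤m+n 4 r) (Johnson-spanning r 1 (s≤s z≤n) (s≤s (s≤s z≤n)))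
Johnson-spanning (suc r) (suc (suc j)) _   k<n with j ℕ.≟ 2 + r
... | yes refl = Johnson-spanning-k=n-1 (2 + r) (ℕ.m≤m+n 4 r) (Johnson-spanning r (3 + r) (s≤s z≤n) (ℕ.n<1+n _))
... | no j≢2+r = Johnson-split-spanning (4 + r) j (ℕ.m≤m+n 4 r) k<n′
                   (Johnson-spanning r (suc j) (s≤s z≤n) (ℕ.<-trans (ℕ.n<1+n _) k<n′))
                   (Johnson-spanning r (2 + j) (s≤s z≤n) k<n′)
  where
  k<n′ : 2 + j < 4 + r
  k<n′ = ℕ.≤∧≢⇒< (ℕ.≤-pred k<n) (j≢2+r ∘ ℕ.suc-injective ∘ ℕ.suc-injective)

theorem4 : (n k : ℕ) → 4 ≤ n → 1 ≤ k → k < n →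
    PairedTwoCoverable (JVertex n k) (JAdj n k)
theorem4 (suc (suc (suc (suc r)))) k (s≤s (s≤s (s≤s (s≤s z≤n)))) 1≤k k<n =
  Linkable⇒PairedTwoCoverable (J (4 + r) k) (Spanning.linkable (Johnson-spanning r k 1≤k k<n))
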